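{- For every monograph $T$, the functor $\mathrm{A}_T:\mathbf{Monogr}/T\to\mathbf{Alg}(\mathrm{S}(T))$ is an equivalence of categories.
   Context: A monograph is a set $A$ of ordered pairs which is a functional relation with domain some set $\mathrm{E}_A$ (the edges) such that each $A(x)$ is a function $\lambda\to\mathrm{E}_A$ for some ordinal $\lambda=|x|$; $x_\iota$ denotes $A(x)(\iota)$. A morphism $f:A\to B$ is a function $f:\mathrm{E}_A\to\mathrm{E}_B$ with $|f(x)|=|x|$ and $f(x_\iota)=f(x)_\iota$; $\mathbf{Monogr}$ is the resulting category, and $\mathbf{Monogr}/T$ the slice category over $T$ (objects: morphisms $a:A\to T$; morphisms $a\to b$, with $b:B\to T$: morphisms $f:A\to B$ with $b\circ f=a$). For a signature $\Sigma:\Omega\to S^{<\omega}$ with unary operators, a $\Sigma$-algebra consists of sets $\mathcal{A}_s$ ($s\in S$) and functions $o^{\mathcal{A}}:\mathcal{A}_{\mathrm{Dom}(o)}\to\mathcal{A}_{\mathrm{Rng}(o)}$; homomorphisms are sort-indexed families of functions commuting with the operations; $\mathbf{Alg}(\Sigma)$ is the resulting category. For a monograph $T$, $\mathrm{S}(T)$ is the signature with sorts $\mathrm{E}_T$ and operator names $[e,\iota]$ for $e\in\mathrm{E}_T$, $\iota<|e|$, of domain sort $e$ and range sort $e_\iota$. The functor $\mathrm{A}_T$ sends $a:A\to T$ to the $\mathrm{S}(T)$-algebra $\mathcal{A}$ with $\mathcal{A}_e=a^{ -1}[\{e\}]$ for $e\in\mathrm{E}_T$ and $[e,\iota]^{\mathcal{A}}(x)=x_\iota$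 for $x\in\mathcal{A}_e$, and sends $f:a\to b$ to the family of restrictions $(f|_{\mathcal{A}_e}:\mathcal{A}_e\to\mathcal{B}_e)_{e\in\mathrm{E}_T}$, where $\mathcal{B}=\mathrm{A}_T(b)$. -}

module Defs where

open import Level using (Level; suc; _⊔_) renaming (zero to 0ℓ)
open import Data.Product using (Σ; _,_; proj₁; proj₂)
open import Relation.Binary.PropositionalEquality
  using (_≡_; refl; sym; trans; cong; subst)

record Category (o h e : Level) : Set (suc (o ⊔ h ⊔ e)) where
  infixr 9 _∘_
  infix  4 _≈_
  field
    Obj  : Set o
    Hom  : Obj → Obj → Set h
    _≈_  : ∀ {A B} → Hom A B → Hom A B → Set e
    id   : ∀ {A} → Hom A A
    _∘_  : ∀ {A B C} → Hom B C → Hom A B → Hom A C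
    ≈-refl  : ∀ {A B} {f : Hom A B} → f ≈ f
    ≈-sym   : ∀ {A B} {f g : Hom A B} → f ≈ g → g ≈ f
    ≈-trans : ∀ {A B} {f g k : Hom A B} → f ≈ g → g ≈ k → f ≈ k
    ∘-resp-≈ : ∀ {A B C} {f f' : Hom B C} {g g' : Hom A B} →
               f ≈ f' → g ≈ g' → (f ∘ g) ≈ (f' ∘ g')
    identityˡ : ∀ {A B} {f : Hom A B} → (id ∘ f) ≈ f
    identityʳ : ∀ {A B} {f : Hom A B} → (f ∘ id) ≈ f
    assoc : ∀ {A B C D} {f : Hom A B} {g : Hom B C} {k : Hom C D} →
            ((k ∘ g) ∘ f) ≈ (k ∘ (g ∘ f))

record Functor {o h e o' h' e'} (C : Category o h e) (D : Category o' h' e')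
       : Set (o ⊔ h ⊔ e ⊔ o' ⊔ h' ⊔ e') where
  private
    module C = Category C
    module D = Category D
  field
    F₀ : C.Obj → D.Obj
    F₁ : ∀ {A B} → C.Hom A B → D.Hom (F₀ A) (F₀ B)
    F-resp-≈ : ∀ {A B} {f g : C.Hom A B} → f C.≈ g → F₁ f D.≈ F₁ g
    F-id : ∀ {A} → F₁ (C.id {A}) D.≈ D.id
    F-∘  : ∀ {A B X} (f : C.Hom A B) (g : C.Hom B X) →
           F₁ (g C.∘ f) D.≈ (F₁ g D.∘ F₁ f)

idF : ∀ {o h e} (C : Category o h e) → Functor C C
idF C = record
  { F₀ = λ A → A ; F₁ = λ f → f ; F-resp-≈ = λ p → p
  ; F-id = ≈-refl ; F-∘ = λ f g → ≈-refl }
  where open Category C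

_∘F_ : ∀ {o h e o' h' e' o'' h'' e''}
         {C : Category o h e} {D : Category o' h' e'} {E : Category o'' h'' e''} →
         Functor D E → Functor C D → Functor C E
_∘F_ {E = E} G F = record
  { F₀ = λ A → G.F₀ (F.F₀ A)
  ; F₁ = λ f → G.F₁ (F.F₁ f)
  ; F-resp-≈ = λ p → G.F-resp-≈ (F.F-resp-≈ p)
  ; F-id = E.≈-trans (G.F-resp-≈ F.F-id) G.F-id
  ; F-∘ = λ f g → E.≈-trans (G.F-resp-≈ (F.F-∘ f g)) (G.F-∘ (F.F₁ f) (F.F₁ g)) }
  where
    module G = Functor G
    module F = Functor F
    module E = Category E

record NatIso {o h e o' h' e'} {C : Category o h e} {D : Category o' h' e'}
       (F G : Functor C D) : Set (o ⊔ h ⊔ e ⊔ o' ⊔ h' ⊔ e') where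
  private
    module C = Category C
    module D = Category D
    module F = Functor F
    module G = Functor G
  field
    η   : ∀ X → D.Hom (F.F₀ X) (G.F₀ X)
    η⁻¹ : ∀ X → D.Hom (G.F₀ X) (F.F₀ X)
    iso-l : ∀ X → (η⁻¹ X D.∘ η X) D.≈ D.id
    iso-r : ∀ X → (η X D.∘ η⁻¹ X) D.≈ D.id
    natural : ∀ {X Y} (f : C.Hom X Y) → (η Y D.∘ F.F₁ f) D.≈ (G.F₁ f D.∘ η X)

record IsEquivalence {o h e o' h' e'} {C : Category o h e} {D : Category o' h' e'}
       (F : Functor C D) : Set (o ⊔ h ⊔ e ⊔ o' ⊔ h' ⊔ e') where
  field
    G    : Functor D C
    unit   : NatIso (idF C) (G ∘F F)
    counit : NatIso (F ∘F G) (idF D)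

subst-sym-subst' : ∀ {A : Set} (P : A → Set) {x y : A} (p : x ≡ y) (z : P y) →
                   subst P p (subst P (sym p) z) ≡ z
subst-sym-subst' P refl z = refl

subst-sym-subst'' : ∀ {A : Set} (P : A → Set) {x y : A} (p : x ≡ y) (z : P x) →
                    subst P (sym p) (subst P p z) ≡ z
subst-sym-subst'' P refl z = refl

subst-sym-trans : ∀ {A : Set} (P : A → Set) {x y z : A} (p : x ≡ y) (q : y ≡ z) (w : P z) →
                  subst P (sym (trans p q)) w ≡ subst P (sym p) (subst P (sym q) w)
subst-sym-trans P refl refl w = refl

module _ (Ar : Set) (Pos : Ar → Set) where

  record Monograph : Set₁ where
    field
      E   : Set
      len : E → Ar
      at  : (x : E) → Pos (len x) → E

  open Monograph

  record MonoHom (A B : Monograph) : Set where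
    field
      fun    : E A → E B
      len-eq : ∀ x → len B (fun x) ≡ len A x
      comm   : ∀ x (ι : Pos (len A x)) →
               fun (at A x ι) ≡ at B (fun x) (subst Pos (sym (len-eq x)) ι)
  open MonoHom

  idM : ∀ {A} → MonoHom A A
  idM = record { fun = λ x → x ; len-eq = λ x → refl ; comm = λ x ι → refl }

  _∘M_ : ∀ {A B C} → MonoHom B C → MonoHom A B → MonoHom A C
  _∘M_ {A} {B} {C} g f = record
    { fun = λ x → fun g (fun f x)
    ; len-eq = λ x → trans (len-eq g (fun f x)) (len-eq f x)
    ; comm = λ x ι → trans (cong (fun g) (comm f x ι))
               (trans (comm g (fun f x) (subst Pos (sym (len-eq f x)) ι))
                 (cong (at C (fun g (fun f x)))
                   (sym (subst-sym-trans Pos (len-eq g (fun f x)) (len-eq f x) ι)))) }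

  record SliceObj (T : Monograph) : Set₁ where
    constructor sliceObj
    field
      dom : Monograph
      arr : MonoHom dom T
  open SliceObj

  record SliceHom {T} (a b : SliceObj T) : Set where
    field
      mor : MonoHom (dom a) (dom b)
      tri : ∀ x → fun (arr b) (fun mor x) ≡ fun (arr a) x
  open SliceHom

  Slice : Monograph → Category (Level.suc 0ℓ) 0ℓ 0ℓ
  Slice T = record
    { Obj = SliceObj T
    ; Hom = SliceHom
    ; _≈_ = λ {a} f g → ∀ x → fun (mor f) x ≡ fun (mor g) x
    ; id = record { mor = idM ; tri = λ x → refl }
    ; _∘_ = λ {a} {b} {c} g f → record
        { mor = mor g ∘M mor f
        ; tri = λ x → trans (tri g (fun (mor f) x)) (tri f x) }
    ; ≈-refl = λ x → refl
    ; ≈-sym = λ p x → sym (p x)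
    ; ≈-trans = λ p q x → trans (p x) (q x)
    ; ∘-resp-≈ = λ {f' = f'} {g = g} p q x → trans (p (fun (mor g) x)) (cong (fun (mor f')) (q x))
    ; identityˡ = λ x → refl
    ; identityʳ = λ x → refl
    ; assoc = λ x → refl }

record UnarySignature : Set₁ where
  field
    Sort : Set
    Op   : Set
    dom  : Op → Sort
    rng  : Op → Sort

module _ (Σ' : UnarySignature) where
  open UnarySignature Σ'

  record Algebra : Set₁ where
    field
      Carrier : Sort → Set
      op      : (o : Op) → Carrier (dom o) → Carrier (rng o)
  open Algebra

  record AlgHom (𝒜 ℬ : Algebra) : Set where
    field
      hom  : ∀ s → Carrier 𝒜 s → Carrier ℬ s
      comm : ∀ o x → hom (rng o) (op 𝒜 o x) ≡ op ℬ o (hom (dom o) x)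
  open AlgHom

  Alg : Category (Level.suc 0ℓ) 0ℓ 0ℓ
  Alg = record
    { Obj = Algebra
    ; Hom = AlgHom
    ; _≈_ = λ h k → ∀ s x → hom h s x ≡ hom k s x
    ; id = record { hom = λ s x → x ; comm = λ o x → refl }
    ; _∘_ = λ g f → record
        { hom = λ s x → hom g s (hom f s x)
        ; comm = λ o x → trans (cong (hom g (rng o)) (comm f o x)) (comm g o (hom f (dom o) x)) }
    ; ≈-refl = λ s x → refl
    ; ≈-sym = λ p s x → sym (p s x)
    ; ≈-trans = λ p q s x → trans (p s x) (q s x)
    ; ∘-resp-≈ = λ {f' = f'} {g = g} p q s x → trans (p s (hom g s x)) (cong (hom f' s) (q s x))
    ; identityˡ = λ s x → refl
    ; identityʳ = λ s x → refl
    ; assoc = λ s x → refl }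

module _ (Ar : Set) (Pos : Ar → Set) where
  open Monograph
  open MonoHom
  open SliceObj
  open SliceHom

  S : Monograph Ar Pos → UnarySignature
  S T = record
    { Sort = E T
    ; Op   = Σ (E T) (λ e → Pos (len T e))
    ; dom  = proj₁
    ; rng  = λ o → at T (proj₁ o) (proj₂ o) }

  Fib : ∀ {T} → SliceObj Ar Pos T → E T → Set
  Fib a e = Σ (E (dom a)) (λ x → fun (arr a) x ≡ e)

  -- [e, ι](x) = x_ι  for x ∈ a⁻¹[{e}]  (ι is transported along |e| = |a x| = |x|)
  fibOpProof : ∀ {T} (a : SliceObj Ar Pos T) (x : E (dom a)) {e} (p : fun (arr a) x ≡ e)
               (ι : Pos (len T e)) →
               fun (arr a) (at (dom a) x (subst Pos (trans (cong (len T) (sym p)) (len-eq (arr a) x)) ι))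
                 ≡ at T e ι
  fibOpProof {T} a x refl ι =
    trans (comm (arr a) x (subst Pos (len-eq (arr a) x) ι))
          (cong (at T (fun (arr a) x)) (subst-sym-subst'' Pos (len-eq (arr a) x) ι))

  fibOp : ∀ {T} (a : SliceObj Ar Pos T) (o : Σ (E T) (λ e → Pos (len T e))) →
          Fib a (proj₁ o) → Fib a (at T (proj₁ o) (proj₂ o))
  fibOp {T} a (e , ι) (x , p) =
      at (dom a) x (subst Pos (trans (cong (len T) (sym p)) (len-eq (arr a) x)) ι)
    , fibOpProof a x p ι

  A₀ : ∀ T → SliceObj Ar Pos T → Algebra (S T)
  A₀ T a = record { Carrier = Fib a ; op = fibOp a }

  fibMap : ∀ {T} {a b : SliceObj Ar Pos T} → SliceHom Ar Pos a b →
           ∀ e → Fib a e → Fib b e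
  fibMap f e (x , p) = fun (mor f) x , trans (tri f x) p

  -- helpers (uniqueness of identity proofs holds: K is on by default)
  uip : ∀ {A : Set} {x y : A} (p q : x ≡ y) → p ≡ q
  uip refl refl = refl

  subst-uip : ∀ {A : Set} (P : A → Set) {x y z : A} (q : x ≡ y) (p : y ≡ z) (r : x ≡ z) (w : P x) →
              subst P p (subst P q w) ≡ subst P r w
  subst-uip P refl refl refl w = refl

  fib-≡ : ∀ {T} {a : SliceObj Ar Pos T} {e} (u v : Fib a e) → proj₁ u ≡ proj₁ v → u ≡ v
  fib-≡ (x , p) (.x , q) refl = cong (x ,_) (uip p q)

  fibMap-comm : ∀ {T} {a b : SliceObj Ar Pos T} (f : SliceHom Ar Pos a b) o x →
                fibMap f (at T (proj₁ o) (proj₂ o)) (fibOp a o x)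
                  ≡ fibOp b o (fibMap f (proj₁ o) x)
  fibMap-comm {T} {a} {b} f (e , ι) (x , p) = fib-≡ {a = b} _ _
    (trans (comm (mor f) x (subst Pos qa ι))
      (cong (at (dom b) (fun (mor f) x))
        (subst-uip Pos qa (sym (len-eq (mor f) x)) qb ι)))
    where
      qa = trans (cong (len T) (sym p)) (len-eq (arr a) x)
      qb = trans (cong (len T) (sym (trans (tri f x) p))) (len-eq (arr b) (fun (mor f) x))

  A-functor : (T : Monograph Ar Pos) → Functor (Slice Ar Pos T) (Alg (S T))
  A-functor T = record
    { F₀ = A₀ T
    ; F₁ = λ f → record { hom = fibMap f ; comm = fibMap-comm f }
    ; F-resp-≈ = λ {B = b} p s x → fib-≡ {a = b} _ _ (p (proj₁ x))
    ; F-id = λ {a} s x → fib-≡ {a = a} _ _ refl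
    ; F-∘ = λ {X = c} f g s x → fib-≡ {a = c} _ _ refl }

{-# OPTIONS --safe #-}
-- An S(T)-algebra 𝒜 is a family of sets over the edges of T together with the
-- action of the edge maps x ↦ x_ι.  Its disjoint union ∐ₑ 𝒜ₑ is therefore itself a
-- monograph, with |(e , c)| = |e| and (e , c)_ι = (e_ι , [e,ι] c), and the first
-- projection is a morphism to T.  This "monograph of elements" inverts A_T: the
-- fibres of the projection over e are copies of 𝒜ₑ, and conversely a monograph
-- over T is recovered, up to isomorphism, as the disjoint union of its fibres.
module Submission where

open import Defs hiding (uip)
open import Axiom.UniquenessOfIdentityProofs.WithK using (uip)
open import Data.Product using (Σ; _,_; proj₁)
open import Relation.Binary.PropositionalEquality
  using (_≡_; refl; sym; trans; cong; subst)
open import Relation.Binary.PropositionalEquality.Properties using (subst-subst-sym)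

subst-irrelevant : ∀ {A : Set} (P : A → Set) {x y : A} (p q : x ≡ y) (z : P x) →
                   subst P p z ≡ subst P q z
subst-irrelevant P p q z = cong (λ r → subst P r z) (uip p q)

module _ (Ar : Set) (Pos : Ar → Set) (T : Monograph Ar Pos) where
  open Monograph
  open MonoHom
  open SliceObj
  open SliceHom
  open Algebra
  open AlgHom

  private
    Sig = S Ar Pos T

  elements : Algebra Sig → Monograph Ar Pos
  elements 𝒜 = record
    { E   = Σ (E T) (Carrier 𝒜)
    ; len = λ (e , _) → len T e
    ; at  = λ (e , c) ι → at T e ι , op 𝒜 (e , ι) c }

  elementsOver : Algebra Sig → SliceObj Ar Pos T
  elementsOver 𝒜 = sliceObj (elements 𝒜) record
    { fun = proj₁ ; len-eq = λ _ → refl ; comm = λ _ _ → refl }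

  elementsMap : ∀ {𝒜 ℬ} → AlgHom Sig 𝒜 ℬ →
                SliceHom Ar Pos (elementsOver 𝒜) (elementsOver ℬ)
  elementsMap f = record
    { mor = record
      { fun    = λ (e , c) → e , hom f e c
      ; len-eq = λ _ → refl
      ; comm   = λ (e , c) ι → cong (at T e ι ,_) (AlgHom.comm f (e , ι) c) }
    ; tri = λ _ → refl }

  Elements : Functor (Alg Sig) (Slice Ar Pos T)
  Elements = record
    { F₀       = elementsOver
    ; F₁       = elementsMap
    ; F-resp-≈ = λ p (e , c) → cong (e ,_) (p e c)
    ; F-id     = λ _ → refl
    ; F-∘      = λ _ _ _ → refl }

  module _ (a : SliceObj Ar Pos T) where

    -- The edges of elements (A_T a) are triples (e , x , p) with p : a x ≡ e.
    fibred-≡ : ∀ {e e' x x'} (p : fun (arr a) x ≡ e) (p' : fun (arr a) x' ≡ e') → x ≡ x' →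
               _≡_ {A = Σ (E T) (Fib Ar Pos a)} (e , x , p) (e' , x' , p')
    fibred-≡ refl refl refl = refl

    toFibres : SliceHom Ar Pos a (elementsOver (A₀ Ar Pos T a))
    toFibres = record
      { mor = record
        { fun    = λ x → fun (arr a) x , x , refl
        ; len-eq = len-eq (arr a)
        ; comm   = λ x ι → fibred-≡ refl _
            (cong (at (dom a) x) (sym (subst-subst-sym {P = Pos} (len-eq (arr a) x)))) }
      ; tri = λ _ → refl }

    fromFibres : SliceHom Ar Pos (elementsOver (A₀ Ar Pos T a)) a
    fromFibres = record
      { mor = record
        { fun    = λ (_ , x , _) → x
        ; len-eq = λ (_ , x , p) → trans (sym (len-eq (arr a) x)) (cong (len T) p)
        ; comm   = λ (_ , x , _) ι → cong (at (dom a) x) (subst-irrelevant Pos _ _ ι) }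
      ; tri = λ (_ , _ , p) → p }

  unit : NatIso (idF (Slice Ar Pos T)) (Elements ∘F A-functor Ar Pos T)
  unit = record
    { η       = toFibres
    ; η⁻¹     = fromFibres
    ; iso-l   = λ _ _ → refl
    ; iso-r   = λ a (_ , _ , p) → fibred-≡ a refl p refl
    ; natural = λ {_} {b} f x → fibred-≡ b refl (trans (tri f x) refl) refl }

  module _ (𝒜 : Algebra Sig) where

    collapse : ∀ e → Fib Ar Pos (elementsOver 𝒜) e → Carrier 𝒜 e
    collapse _ ((_ , c) , refl) = c

    collapse-comm : ∀ o y → collapse _ (fibOp Ar Pos (elementsOver 𝒜) o y)
                            ≡ op 𝒜 o (collapse _ y)
    collapse-comm _ ((_ , _) , refl) = refl

    fromElements : AlgHom Sig (A₀ Ar Pos T (elementsOver 𝒜)) 𝒜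
    fromElements = record { hom = collapse ; comm = collapse-comm }

    toElements : AlgHom Sig 𝒜 (A₀ Ar Pos T (elementsOver 𝒜))
    toElements = record
      { hom  = λ e c → (e , c) , refl
      ; comm = λ _ _ → fib-≡ Ar Pos {a = elementsOver 𝒜} _ _ refl }

    collapse-section : ∀ e y → ((e , collapse e y) , refl) ≡ y
    collapse-section _ ((_ , _) , refl) = refl

  collapse-natural : ∀ {𝒜 ℬ} (f : AlgHom Sig 𝒜 ℬ) e y →
                     collapse ℬ e (fibMap Ar Pos (elementsMap f) e y) ≡ hom f e (collapse 𝒜 e y)
  collapse-natural _ _ ((_ , _) , refl) = refl

  counit : NatIso (A-functor Ar Pos T ∘F Elements) (idF (Alg Sig))
  counit = record
    { η       = fromElements
    ; η⁻¹     = toElements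
    ; iso-l   = collapse-section
    ; iso-r   = λ _ _ _ → refl
    ; natural = collapse-natural }

theorem5 : (Ar : Set) (Pos : Ar → Set) (T : Monograph Ar Pos) →
    IsEquivalence (A-functor Ar Pos T)
theorem5 Ar Pos T = record
  { G      = Elements Ar Pos T
  ; unit   = unit Ar Pos T
  ; counit = counit Ar Pos T }
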